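{- Let $n=4k\ge4$ and let $w$ be a minimum dominating word for $G_n$. Then $w\in\{\mathrm{C},\mathrm{A},\mathrm{B}\}^n$, with $\#\mathrm{C}=2k$ and $\#\{\mathrm{A},\mathrm{B}\}=2k$ (number of letters equal to $\mathrm{A}$ or $\mathrm{B}$), and, up to cyclic rotation, $w\in\{(\mathrm{B}\mathrm{C}\mathrm{A}\mathrm{C})^k,(\mathrm{A}\mathrm{C}\mathrm{B}\mathrm{C})^k\}$.
   Context: For $n\ge3$, $G_n=C_n\square P_2$ has vertex set $\{(t,i),(b,i): i\in\mathbb{Z}_n\}$ (indices mod $n$), with $(t,i)$ adjacent to $(t,i\pm1)$ and $(b,i)$, and $(b,i)$ adjacent to $(b,i\pm1)$ and $(t,i)$. A set $S\subseteq V(G_n)$ is encoded by the cyclic word $w\in\{\mathrm{C},\mathrm{A},\mathrm{B},\mathrm{D}\}^n$ where column $i$ is $\mathrm{C}$ if neither $(t,i)$ nor $(b,i)$ is in $S$, $\mathrm{A}$ if only $(t,i)\in S$, $\mathrm{B}$ if only $(b,i)\in S$, $\mathrm{D}$ if both are. The weight of $w$ is $\#\mathrm{A}+\#\mathrm{B}+2\#\mathrm{D}=|S|$. A minimum dominating word is a word encoding a dominating set with weight equal to the domination number $\gamma(G_n)$. -}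

module Defs where

open import Data.Nat using (ℕ; zero; suc; _+_; _*_; _≤_)
open import Data.Fin using (Fin; toℕ)
open import Data.List using (List; map; allFin)
open import Data.Nat.ListAction using (sum)
open import Data.Product using (_×_; Σ; ∃; _,_)
open import Data.Sum using (_⊎_)
open import Relation.Binary.PropositionalEquality using (_≡_; _≢_)

data Letter : Set where
  C A B D : Letter

-- Words of length n: column i ↦ letter (indices are Fin n, read mod n)
Word : ℕ → Set
Word n = Fin n → Letter

-- Rows of G_n = C_n □ P_2
data Side : Set where
  t b : Side

Vertex : ℕ → Set
Vertex n = Side × Fin n

CycSucc : {n : ℕ} → Fin n → Fin n → Set
CycSucc {n} i j = (toℕ j ≡ suc (toℕ i)) ⊎ ((toℕ j ≡ 0) × (suc (toℕ i) ≡ n))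

data Adj {n : ℕ} : Vertex n → Vertex n → Set where
  row-succ : ∀ {s i j} → CycSucc i j → Adj (s , i) (s , j)
  row-pred : ∀ {s i j} → CycSucc j i → Adj (s , i) (s , j)
  rung-tb  : ∀ {i} → Adj (t , i) (b , i)
  rung-bt  : ∀ {i} → Adj (b , i) (t , i)

data InCol : Letter → Side → Set where
  A-t : InCol A t
  B-b : InCol B b
  D-t : InCol D t
  D-b : InCol D b

InS : {n : ℕ} → Word n → Vertex n → Set
InS w (s , i) = InCol (w i) s

Dominating : {n : ℕ} → Word n → Set
Dominating {n} w = (v : Vertex n) → InS w v ⊎ (Σ (Vertex n) λ u → InS w u × Adj u v)

-- weight = #A + #B + 2 #D = |S|
letterWeight : Letter → ℕ
letterWeight C = 0
letterWeight A = 1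
letterWeight B = 1
letterWeight D = 2

weight : {n : ℕ} → Word n → ℕ
weight {n} w = sum (map (λ i → letterWeight (w i)) (allFin n))

MinDominating : {n : ℕ} → Word n → Set
MinDominating {n} w = Dominating w × ((v : Word n) → Dominating v → weight w ≤ weight v)

isC : Letter → ℕ
isC C = 1
isC _ = 0

isAB : Letter → ℕ
isAB A = 1
isAB B = 1
isAB _ = 0

countC : {n : ℕ} → Word n → ℕ
countC {n} w = sum (map (λ i → isC (w i)) (allFin n))

countAB : {n : ℕ} → Word n → ℕ
countAB {n} w = sum (map (λ i → isAB (w i)) (allFin n))

patBCAC : ℕ → Letter
patBCAC 0 = B
patBCAC 1 = C
patBCAC 2 = A
patBCAC 3 = C
patBCAC (suc (suc (suc (suc m)))) = patBCAC m

patACBC : ℕ → Letter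
patACBC 0 = A
patACBC 1 = C
patACBC 2 = B
patACBC 3 = C
patACBC (suc (suc (suc (suc m)))) = patACBC m

-- w is a cyclic rotation of the length-n prefix of the periodic pattern p
-- (when 4 ∣ n this is exactly: w is a rotation of p restricted to 0..n-1, e.g. (BCAC)^k)
RotationOf : {n : ℕ} → (ℕ → Letter) → Word n → Set
RotationOf {n} p w = Σ (Fin n) λ r → (i : Fin n) → w i ≡ p (toℕ i + toℕ r)

{-# OPTIONS --safe #-}
module Submission where

-- A column is dominated within the window formed by it and its two neighbours
-- when each of its two vertices is in S or has a neighbour in S inside that
-- window, and S is dominating iff every column is.  Four consecutive columns
-- whose two middle columns are so dominated carry weight at least 2; summing
-- over the n cyclic windows of width four gives 4|S| ≥ 2n, and (BCAC)^k attains
-- this.  A minimum word therefore has every window of width four of weight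
-- exactly 2.  A finite check on six consecutive columns shows that then any
-- three consecutive letters occur consecutively in (BCAC)^ω, and since two
-- consecutive letters of that pattern determine the next one, the word is a
-- rotation of (BCAC)^k.

open import Defs
open import Data.Empty using (⊥-elim)
open import Data.Fin using (Fin; zero; suc; toℕ; inject≤)
open import Data.Fin.Properties using (any?; toℕ-injective; toℕ<n; toℕ-fromℕ<; toℕ-inject≤)
open import Data.List using ([]; _∷_; [_]; _++_; map; allFin; tabulate; applyUpTo; length)
open import Data.List.Properties using (applyUpTo-∷ʳ; map-tabulate; length-applyUpTo)
open import Data.List.Relation.Unary.All using (All; []; _∷_)
open import Data.List.Relation.Unary.All.Properties using (applyUpTo⁺₂; applyUpTo⁻)
open import Data.Nat using (ℕ; zero; suc; pred; _+_; _*_; _≤_; _≤?_; z≤n; NonZero; _%_; _/_)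
open import Data.Nat.DivMod using (_mod_; m≡m%n+[m/n]*n; [m+n]%n≡m%n; [m+kn]%n≡m%n; m<n⇒m%n≡m; m%n<n; n%n≡0)
open import Data.Nat.ListAction using (sum)
open import Data.Nat.ListAction.Properties using (sum-++)
open import Data.Nat.Properties as ℕ
  using (+-assoc; +-comm; +-suc; +-identityʳ; *-comm; *-assoc; suc-pred; suc-injective; <⇒≢;
         ≤-reflexive; ≤-trans; ≤-antisym; +-mono-≤; +-monoˡ-≤; +-monoʳ-≤; +-cancelˡ-≤; +-cancelʳ-≤;
         +-cancelˡ-≡; *-monoʳ-≤; m*n≢0; m≤m*n; m≤n⇒m<n∨m≡n; module ≤-Reasoning)
open import Algebra.Properties.CommutativeSemigroup ℕ.+-commutativeSemigroup using (interchange; x∙yz≈y∙xz)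
open import Data.Product using (_×_; Σ; Σ-syntax; _,_; proj₁; proj₂)
open import Data.Sum using (_⊎_; inj₁; inj₂)
open import Function using (_∘_)
open import Relation.Binary.Definitions using (DecidableEquality)
open import Relation.Binary.PropositionalEquality
  using (_≡_; _≢_; _≗_; refl; sym; trans; cong; cong₂; subst; module ≡-Reasoning)
open import Relation.Nullary using (Dec; yes; no)
open import Relation.Nullary.Decidable using (_×-dec_; _⊎-dec_; _→-dec_; map′; from-yes)

code : Letter → ℕ
code C = 0
code A = 1
code B = 2
code D = 3

decode : ℕ → Letter
decode 0 = C
decode 1 = A
decode 2 = B
decode _ = D

decode-code : ∀ x → decode (code x) ≡ x
decode-code C = refl
decode-code A = refl
decode-code B = refl
decode-code D = refl

_≟_ : DecidableEquality Letter
x ≟ y = map′ code-injective (cong code) (code x ℕ.≟ code y)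
  where
  code-injective : code x ≡ code y → x ≡ y
  code-injective e = trans (sym (decode-code x)) (trans (cong decode e) (decode-code y))

∀-Letter? : {P : Letter → Set} → (∀ x → Dec (P x)) → Dec (∀ x → P x)
∀-Letter? P? = map′ (λ { (pC , pA , pB , pD) → λ { C → pC ; A → pA ; B → pB ; D → pD } })
  (λ p → p C , p A , p B , p D) (P? C ×-dec P? A ×-dec P? B ×-dec P? D)

∀-Side? : {P : Side → Set} → (∀ s → Dec (P s)) → Dec (∀ s → P s)
∀-Side? P? = map′ (λ { (pt , pb) → λ { t → pt ; b → pb } }) (λ p → p t , p b) (P? t ×-dec P? b)

InCol? : ∀ x s → Dec (InCol x s)
InCol? A t = yes A-t
InCol? B b = yes B-b
InCol? D t = yes D-t
InCol? D b = yes D-b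
InCol? C t = no λ ()
InCol? C b = no λ ()
InCol? A b = no λ ()
InCol? B t = no λ ()

opposite : Side → Side
opposite t = b
opposite b = t

MiddleDominated : Letter → Letter → Letter → Set
MiddleDominated x y z = ∀ s → InCol y s ⊎ InCol y (opposite s) ⊎ InCol x s ⊎ InCol z s

middleDominated? : ∀ x y z → Dec (MiddleDominated x y z)
middleDominated? x y z =
  ∀-Side? λ s → InCol? y s ⊎-dec InCol? y (opposite s) ⊎-dec InCol? x s ⊎-dec InCol? z s

LocallyDominating : (ℕ → Letter) → Set
LocallyDominating f = ∀ m → MiddleDominated (f m) (f (1 + m)) (f (2 + m))

locallyDominating-resp : ∀ {f g} → f ≗ g → LocallyDominating g → LocallyDominating f
locallyDominating-resp f≗g dom m rewrite f≗g m | f≗g (1 + m) | f≗g (2 + m) = dom m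

Periodic : {X : Set} → ℕ → (ℕ → X) → Set
Periodic p f = ∀ m → f (p + m) ≡ f m

module _ {X : Set} {p : ℕ} {f : ℕ → X} where

  periodic-∘suc : Periodic p f → Periodic p (f ∘ suc)
  periodic-∘suc per m = trans (cong f (sym (+-suc p m))) (per (suc m))

  periodic-* : Periodic p f → ∀ q → Periodic (q * p) f
  periodic-* per zero    m = refl
  periodic-* per (suc q) m =
    trans (cong f (+-assoc p (q * p) m)) (trans (per (q * p + m)) (periodic-* per q m))

  periodic-% : .{{_ : NonZero p}} → Periodic p f → ∀ m → f (m % p) ≡ f m
  periodic-% per m = begin
    f (m % p)               ≡⟨ periodic-* per (m / p) (m % p) ⟨
    f (m / p * p + m % p)   ≡⟨ cong f (+-comm (m / p * p) (m % p)) ⟩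
    f (m % p + m / p * p)   ≡⟨ cong f (m≡m%n+[m/n]*n m p) ⟨
    f m                     ∎
    where open ≡-Reasoning

applyUpTo-cong : {X : Set} {f g : ℕ → X} → f ≗ g → ∀ n → applyUpTo f n ≡ applyUpTo g n
applyUpTo-cong f≗g zero    = refl
applyUpTo-cong f≗g (suc n) = cong₂ _∷_ (f≗g 0) (applyUpTo-cong (f≗g ∘ suc) n)

applyUpTo-+ : {X : Set} (f : ℕ → X) (m n : ℕ) →
              applyUpTo f (m + n) ≡ applyUpTo f m ++ applyUpTo (λ j → f (m + j)) n
applyUpTo-+ f zero    n = refl
applyUpTo-+ f (suc m) n = cong (f 0 ∷_) (applyUpTo-+ (f ∘ suc) m n)

tabulate≡applyUpTo : {X : Set} {n : ℕ} {f : Fin n → X} {g : ℕ → X} →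
                     (∀ i → f i ≡ g (toℕ i)) → tabulate f ≡ applyUpTo g n
tabulate≡applyUpTo {n = zero}  _   = refl
tabulate≡applyUpTo {n = suc n} f≗g = cong₂ _∷_ (f≗g zero) (tabulate≡applyUpTo (f≗g ∘ suc))

sum-map-allFin : ∀ {n} {f : Fin n → ℕ} {g : ℕ → ℕ} →
                 (∀ i → f i ≡ g (toℕ i)) → sum (map f (allFin n)) ≡ sum (applyUpTo g n)
sum-map-allFin {f = f} f≗g = cong sum (trans (map-tabulate (λ i → i) f) (tabulate≡applyUpTo f≗g))

sum-applyUpTo-+ : ∀ (f g : ℕ → ℕ) n →
                  sum (applyUpTo (λ m → f m + g m) n) ≡ sum (applyUpTo f n) + sum (applyUpTo g n)
sum-applyUpTo-+ f g zero    = refl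
sum-applyUpTo-+ f g (suc n) =
  trans (cong (f 0 + g 0 +_) (sum-applyUpTo-+ (f ∘ suc) (g ∘ suc) n)) (interchange (f 0) (g 0) _ _)

windowSum : (ℕ → ℕ) → ℕ → ℕ → ℕ
windowSum f ℓ m = sum (applyUpTo (λ j → f (j + m)) ℓ)

module _ {p : ℕ} where

  sum-applyUpTo-∘suc : ∀ {f} → Periodic p f → sum (applyUpTo (f ∘ suc) p) ≡ sum (applyUpTo f p)
  sum-applyUpTo-∘suc {f} per = +-cancelˡ-≡ (f 0) _ _ (begin
    f 0 + sum (applyUpTo (f ∘ suc) p)  ≡⟨ cong sum (applyUpTo-∷ʳ f p) ⟨
    sum (applyUpTo f p ++ [ f p ])     ≡⟨ sum-++ (applyUpTo f p) [ f p ] ⟩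
    sum (applyUpTo f p) + (f p + 0)    ≡⟨ cong (sum (applyUpTo f p) +_) (trans (+-identityʳ (f p)) fp≡f0) ⟩
    sum (applyUpTo f p) + f 0          ≡⟨ +-comm _ (f 0) ⟩
    f 0 + sum (applyUpTo f p)          ∎)
    where
    open ≡-Reasoning
    fp≡f0 : f p ≡ f 0
    fp≡f0 = trans (cong f (sym (+-identityʳ p))) (per 0)

  sum-applyUpTo-rotate : ∀ {f} → Periodic p f → ∀ r →
                         sum (applyUpTo (λ m → f (r + m)) p) ≡ sum (applyUpTo f p)
  sum-applyUpTo-rotate per zero    = refl
  sum-applyUpTo-rotate per (suc r) =
    trans (sum-applyUpTo-rotate (periodic-∘suc per) r) (sum-applyUpTo-∘suc per)

  sum-applyUpTo-periodic : ∀ {f} → Periodic p f → ∀ q →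
                           sum (applyUpTo f (q * p)) ≡ q * sum (applyUpTo f p)
  sum-applyUpTo-periodic     per zero    = refl
  sum-applyUpTo-periodic {f} per (suc q) = begin
    sum (applyUpTo f (p + q * p))                                    ≡⟨ cong sum (applyUpTo-+ f p (q * p)) ⟩
    sum (applyUpTo f p ++ applyUpTo (λ j → f (p + j)) (q * p))       ≡⟨ sum-++ (applyUpTo f p) _ ⟩
    sum (applyUpTo f p) + sum (applyUpTo (λ j → f (p + j)) (q * p))  ≡⟨ cong (λ xs → Σf + sum xs) (applyUpTo-cong per (q * p)) ⟩
    sum (applyUpTo f p) + sum (applyUpTo f (q * p))                  ≡⟨ cong (Σf +_) (sum-applyUpTo-periodic per q) ⟩
    sum (applyUpTo f p) + q * sum (applyUpTo f p)                    ∎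
    where
    open ≡-Reasoning
    Σf : ℕ
    Σf = sum (applyUpTo f p)

  periodic-windowSum : ∀ {f} → Periodic p f → ∀ ℓ → Periodic p (windowSum f ℓ)
  periodic-windowSum {f} per ℓ m =
    cong sum (applyUpTo-cong (λ j → trans (cong f (x∙yz≈y∙xz j p m)) (per (j + m))) ℓ)

  sum-windowSum : ∀ {f} → Periodic p f → ∀ ℓ →
                  sum (applyUpTo (windowSum f ℓ) p) ≡ ℓ * sum (applyUpTo f p)
  sum-windowSum per zero = sum-zeros p
    where
    sum-zeros : ∀ n → sum (applyUpTo (λ _ → 0) n) ≡ 0
    sum-zeros zero    = refl
    sum-zeros (suc n) = sum-zeros n
  sum-windowSum {f} per (suc ℓ) = begin
    sum (applyUpTo (λ m → f m + windowSum (f ∘ suc) ℓ m) p)          ≡⟨ sum-applyUpTo-+ f _ p ⟩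
    sum (applyUpTo f p) + sum (applyUpTo (windowSum (f ∘ suc) ℓ) p)  ≡⟨ cong (Σf +_) (sum-windowSum (periodic-∘suc per) ℓ) ⟩
    sum (applyUpTo f p) + ℓ * sum (applyUpTo (f ∘ suc) p)            ≡⟨ cong (λ s → Σf + ℓ * s) (sum-applyUpTo-∘suc per) ⟩
    sum (applyUpTo f p) + ℓ * sum (applyUpTo f p)                    ∎
    where
    open ≡-Reasoning
    Σf : ℕ
    Σf = sum (applyUpTo f p)

module _ {c : ℕ} where

  length*≤sum : ∀ {xs} → All (c ≤_) xs → length xs * c ≤ sum xs
  length*≤sum []           = z≤n
  length*≤sum (c≤x ∷ c≤xs) = +-mono-≤ c≤x (length*≤sum c≤xs)

  sum≤length*⇒all≡ : ∀ {xs} → All (c ≤_) xs → sum xs ≤ length xs * c → All (_≡ c) xs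
  sum≤length*⇒all≡ []                              _  = []
  sum≤length*⇒all≡ {x ∷ xs} (c≤x ∷ c≤xs) le = ≤-antisym x≤c c≤x ∷ sum≤length*⇒all≡ c≤xs rest≤
    where
    x≤c : x ≤ c
    x≤c = +-cancelʳ-≤ (length xs * c) x c (≤-trans (+-monoʳ-≤ x (length*≤sum c≤xs)) le)
    rest≤ : sum xs ≤ length xs * c
    rest≤ = +-cancelˡ-≤ c (sum xs) _ (≤-trans (+-monoˡ-≤ (sum xs) c≤x) le)

  periodic-sum≤⇒≡ : ∀ {p f} .{{_ : NonZero p}} → Periodic p f → (∀ m → c ≤ f m) →
                    sum (applyUpTo f p) ≤ p * c → ∀ m → f m ≡ c
  periodic-sum≤⇒≡ {p} {f} per c≤f le m =
    trans (sym (periodic-% per m)) (applyUpTo⁻ f p all≡c (m%n<n m p))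
    where
    all≡c : All (_≡ c) (applyUpTo f p)
    all≡c = sum≤length*⇒all≡ (applyUpTo⁺₂ f p c≤f)
              (subst (λ l → sum (applyUpTo f p) ≤ l * c) (sym (length-applyUpTo f p)) le)

module _ {n : ℕ} where

  CycSucc-injective : ∀ {i i′ j : Fin n} → CycSucc i j → CycSucc i′ j → i ≡ i′
  CycSucc-injective (inj₁ e)       (inj₁ e′)       = toℕ-injective (suc-injective (trans (sym e) e′))
  CycSucc-injective (inj₁ e)       (inj₂ (e′ , _)) with () ← trans (sym e) e′
  CycSucc-injective (inj₂ (e , _)) (inj₁ e′)       with () ← trans (sym e′) e
  CycSucc-injective (inj₂ (_ , e)) (inj₂ (_ , e′)) = toℕ-injective (suc-injective (trans e (sym e′)))

  CycSucc-functional : ∀ {i j j′ : Fin n} → CycSucc i j → CycSucc i j′ → j ≡ j′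
  CycSucc-functional           (inj₁ e)       (inj₁ e′)       = toℕ-injective (trans e (sym e′))
  CycSucc-functional {j = j}   (inj₁ e)       (inj₂ (_ , e′)) = ⊥-elim (<⇒≢ (toℕ<n j) (trans e e′))
  CycSucc-functional {j′ = j′} (inj₂ (_ , e)) (inj₁ e′)       = ⊥-elim (<⇒≢ (toℕ<n j′) (trans e′ e))
  CycSucc-functional           (inj₂ (e , _)) (inj₂ (e′ , _)) = toℕ-injective (trans e (sym e′))

  module _ (w : Word n) {i j k : Fin n} (i→j : CycSucc i j) (j→k : CycSucc j k) where

    dominating⇒middleDominated : Dominating w → MiddleDominated (w i) (w j) (w k)
    dominating⇒middleDominated dom s with dom (s , j)
    ... | inj₁ p                         = inj₁ p
    ... | inj₂ (_ , p , row-succ i′→j)  = inj₂ (inj₂ (inj₁ (subst (λ l → InCol (w l) s) (CycSucc-injective i′→j i→j) p)))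
    ... | inj₂ (_ , p , row-pred j→k′)  = inj₂ (inj₂ (inj₂ (subst (λ l → InCol (w l) s) (CycSucc-functional j→k′ j→k) p)))
    ... | inj₂ (_ , p , rung-tb)        = inj₂ (inj₁ p)
    ... | inj₂ (_ , p , rung-bt)        = inj₂ (inj₁ p)

    middleDominated⇒dominated : MiddleDominated (w i) (w j) (w k) →
                                ∀ s → InS w (s , j) ⊎ Σ (Vertex n) λ u → InS w u × Adj u (s , j)
    middleDominated⇒dominated dom s with dom s
    middleDominated⇒dominated _ s | inj₁ p               = inj₁ p
    middleDominated⇒dominated _ t | inj₂ (inj₁ p)        = inj₂ ((b , j) , p , rung-bt)
    middleDominated⇒dominated _ b | inj₂ (inj₁ p)        = inj₂ ((t , j) , p , rung-tb)
    middleDominated⇒dominated _ s | inj₂ (inj₂ (inj₁ p)) = inj₂ ((s , i) , p , row-succ i→j)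
    middleDominated⇒dominated _ s | inj₂ (inj₂ (inj₂ p)) = inj₂ ((s , k) , p , row-pred j→k)

module _ {n : ℕ} .{{_ : NonZero n}} where

  toℕ-mod : ∀ m → toℕ (m mod n) ≡ m % n
  toℕ-mod m = toℕ-fromℕ< (m%n<n m n)

  mod-toℕ : ∀ (i : Fin n) → toℕ i mod n ≡ i
  mod-toℕ i = toℕ-injective (trans (toℕ-mod (toℕ i)) (m<n⇒m%n≡m (toℕ<n i)))

  mod-periodic : ∀ m → (n + m) mod n ≡ m mod n
  mod-periodic m = toℕ-injective (begin
    toℕ ((n + m) mod n)  ≡⟨ toℕ-mod (n + m) ⟩
    (n + m) % n          ≡⟨ cong (_% n) (+-comm n m) ⟩
    (m + n) % n          ≡⟨ [m+n]%n≡m%n m n ⟩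
    m % n                ≡⟨ toℕ-mod m ⟨
    toℕ (m mod n)        ∎)
    where open ≡-Reasoning

  [1+m]%n≡[1+m%n]%n : ∀ m → suc m % n ≡ suc (m % n) % n
  [1+m]%n≡[1+m%n]%n m =
    trans (cong (λ l → suc l % n) (m≡m%n+[m/n]*n m n)) ([m+kn]%n≡m%n (suc (m % n)) (m / n) n)

  CycSucc-mod : ∀ m → CycSucc (m mod n) (suc m mod n)
  CycSucc-mod m with m≤n⇒m<n∨m≡n (m%n<n m n)
  ... | inj₁ 1+m%n<n = inj₁ (begin
    toℕ (suc m mod n)     ≡⟨ toℕ-mod (suc m) ⟩
    suc m % n             ≡⟨ [1+m]%n≡[1+m%n]%n m ⟩
    suc (m % n) % n       ≡⟨ m<n⇒m%n≡m 1+m%n<n ⟩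
    suc (m % n)           ≡⟨ cong suc (toℕ-mod m) ⟨
    suc (toℕ (m mod n))   ∎)
    where open ≡-Reasoning
  ... | inj₂ 1+m%n≡n = inj₂ (first-column , trans (cong suc (toℕ-mod m)) 1+m%n≡n)
    where
    open ≡-Reasoning
    first-column : toℕ (suc m mod n) ≡ 0
    first-column = begin
      toℕ (suc m mod n)   ≡⟨ toℕ-mod (suc m) ⟩
      suc m % n           ≡⟨ [1+m]%n≡[1+m%n]%n m ⟩
      suc (m % n) % n     ≡⟨ cong (_% n) 1+m%n≡n ⟩
      n % n               ≡⟨ n%n≡0 n ⟩
      0                   ∎

  cyclic : Word n → ℕ → Letter
  cyclic w m = w (m mod n)

  cyclic-toℕ : ∀ w i → cyclic w (toℕ i) ≡ w i
  cyclic-toℕ w i = cong w (mod-toℕ i)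

  cyclic-periodic : ∀ w → Periodic n (cyclic w)
  cyclic-periodic w m = cong w (mod-periodic m)

  cyclic-restrict : ∀ {f} → Periodic n f → cyclic (λ i → f (toℕ i)) ≗ f
  cyclic-restrict {f} per m = trans (cong f (toℕ-mod m)) (periodic-% per m)

  weight≡sum-cyclic : ∀ w → weight w ≡ sum (applyUpTo (letterWeight ∘ cyclic w) n)
  weight≡sum-cyclic w = sum-map-allFin (λ i → cong letterWeight (sym (cyclic-toℕ w i)))

  dominating⇒locallyDominating : ∀ {w} → Dominating w → LocallyDominating (cyclic w)
  dominating⇒locallyDominating {w} dom m =
    dominating⇒middleDominated w (CycSucc-mod m) (CycSucc-mod (suc m)) dom

  locallyDominating⇒dominating : ∀ {w} → LocallyDominating (cyclic w) → Dominating w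
  locallyDominating⇒dominating {w} dom (s , j) =
    subst (λ l → InS w (s , l) ⊎ Σ (Vertex n) λ u → InS w u × Adj u (s , l)) suc-m≡j
      (middleDominated⇒dominated w (CycSucc-mod m) (CycSucc-mod (suc m)) (dom m) s)
    where
    m : ℕ
    m = pred n + toℕ j
    suc-m≡j : suc m mod n ≡ j
    suc-m≡j = trans (cong (λ l → (l + toℕ j) mod n) (suc-pred n)) (trans (mod-periodic (toℕ j)) (mod-toℕ j))

patBCAC-periodic : Periodic 4 patBCAC
patBCAC-periodic m = refl

patBCAC-≢D : ∀ m → patBCAC m ≢ D
patBCAC-≢D 0 ()
patBCAC-≢D 1 ()
patBCAC-≢D 2 ()
patBCAC-≢D 3 ()
patBCAC-≢D (suc (suc (suc (suc m)))) = patBCAC-≢D m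

patBCAC-locallyDominating : LocallyDominating patBCAC
patBCAC-locallyDominating 0 = from-yes (middleDominated? B C A)
patBCAC-locallyDominating 1 = from-yes (middleDominated? C A C)
patBCAC-locallyDominating 2 = from-yes (middleDominated? A C B)
patBCAC-locallyDominating 3 = from-yes (middleDominated? C B C)
patBCAC-locallyDominating (suc (suc (suc (suc m)))) = patBCAC-locallyDominating m

patBCAC-determined : ∀ x y → patBCAC x ≡ patBCAC y → patBCAC (1 + x) ≡ patBCAC (1 + y) →
                     patBCAC (2 + x) ≡ patBCAC (2 + y)
patBCAC-determined x y e₀ e₁ = begin
  patBCAC (2 + x)                     ≡⟨ patBCAC-next x ⟩
  next (patBCAC x) (patBCAC (1 + x))  ≡⟨ cong₂ next e₀ e₁ ⟩
  next (patBCAC y) (patBCAC (1 + y))  ≡⟨ patBCAC-next y ⟨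
  patBCAC (2 + y)                     ∎
  where
  open ≡-Reasoning
  next : Letter → Letter → Letter
  next B C = A
  next A C = B
  next _ _ = C
  patBCAC-next : ∀ m → patBCAC (2 + m) ≡ next (patBCAC m) (patBCAC (1 + m))
  patBCAC-next 0 = refl
  patBCAC-next 1 = refl
  patBCAC-next 2 = refl
  patBCAC-next 3 = refl
  patBCAC-next (suc (suc (suc (suc m)))) = patBCAC-next m

OccursInBCAC : Letter → Letter → Letter → Set
OccursInBCAC x y z =
  Σ[ r ∈ Fin 4 ] x ≡ patBCAC (toℕ r) × y ≡ patBCAC (1 + toℕ r) × z ≡ patBCAC (2 + toℕ r)

occursInBCAC? : ∀ x y z → Dec (OccursInBCAC x y z)
occursInBCAC? x y z =
  any? λ r → x ≟ patBCAC (toℕ r) ×-dec y ≟ patBCAC (1 + toℕ r) ×-dec z ≟ patBCAC (2 + toℕ r)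

occursInBCAC⇒shiftBCAC : ∀ {f : ℕ → Letter} → (∀ m → OccursInBCAC (f m) (f (1 + m)) (f (2 + m))) →
                         Σ[ r ∈ Fin 4 ] ∀ m → f m ≡ patBCAC (m + toℕ r)
occursInBCAC⇒shiftBCAC {f} occurs = r , proj₁ ∘ shifted
  where
  r : Fin 4
  r = proj₁ (occurs 0)
  shifted : ∀ m → f m ≡ patBCAC (m + toℕ r) × f (1 + m) ≡ patBCAC (1 + m + toℕ r)
  shifted zero with occurs 0
  ... | _ , e₀ , e₁ , _ = e₀ , e₁
  shifted (suc m) with shifted m | occurs m
  ... | eₘ , eₘ₊₁ | r′ , e₀ , e₁ , e₂ =
    eₘ₊₁ , trans e₂ (patBCAC-determined (toℕ r′) (m + toℕ r) (trans (sym e₀) eₘ) (trans (sym e₁) eₘ₊₁))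

sum-shiftBCAC : ∀ k r {w : Word (4 * k)} → (∀ i → w i ≡ patBCAC (toℕ i + r)) → (g : Letter → ℕ) →
                sum (map (λ i → g (w i)) (allFin (4 * k))) ≡ sum (applyUpTo (g ∘ patBCAC) 4) * k
sum-shiftBCAC k r {w} w≡ g = begin
  sum (map (λ i → g (w i)) (allFin (4 * k)))           ≡⟨ sum-map-allFin (λ i → cong g (w≡ i)) ⟩
  sum (applyUpTo (λ m → g (patBCAC (m + r))) (4 * k))  ≡⟨ cong (sum ∘ applyUpTo _) (*-comm 4 k) ⟩
  sum (applyUpTo (λ m → g (patBCAC (m + r))) (k * 4))  ≡⟨ sum-applyUpTo-periodic {p = 4} (λ _ → refl) k ⟩
  k * sum (applyUpTo (λ m → g (patBCAC (m + r))) 4)    ≡⟨ cong (λ xs → k * sum xs) (applyUpTo-cong (λ m → cong (g ∘ patBCAC) (+-comm m r)) 4) ⟩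
  k * sum (applyUpTo (λ m → g (patBCAC (r + m))) 4)    ≡⟨ cong (k *_) (sum-applyUpTo-rotate {p = 4} {g ∘ patBCAC} (λ _ → refl) r) ⟩
  k * sum (applyUpTo (g ∘ patBCAC) 4)                  ≡⟨ *-comm k _ ⟩
  sum (applyUpTo (g ∘ patBCAC) 4) * k                  ∎
  where open ≡-Reasoning

module _ (k : ℕ) .{{_ : NonZero k}} where

  private instance
    4k≢0 : NonZero (4 * k)
    4k≢0 = m*n≢0 4 k

  BCAC-word : Word (4 * k)
  BCAC-word i = patBCAC (toℕ i)

  BCAC-word-dominating : Dominating BCAC-word
  BCAC-word-dominating = locallyDominating⇒dominating
    (locallyDominating-resp (cyclic-restrict {n = 4 * k} {patBCAC} periodic) patBCAC-locallyDominating)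
    where
    periodic : Periodic (4 * k) patBCAC
    periodic = subst (λ p → Periodic p patBCAC) (*-comm k 4) (periodic-* patBCAC-periodic k)

  weight-BCAC-word : weight BCAC-word ≡ 2 * k
  weight-BCAC-word = sum-shiftBCAC k 0 (λ i → cong patBCAC (sym (+-identityʳ (toℕ i)))) letterWeight

-- A list sum, so that it is definitionally the window sum `windowSum f 4 m`.
weight₄ : Letter → Letter → Letter → Letter → ℕ
weight₄ x₀ x₁ x₂ x₃ = sum (map letterWeight (x₀ ∷ x₁ ∷ x₂ ∷ x₃ ∷ []))

-- Opaque, so that applying these lemmas to symbolic letters never unfolds the
-- decision procedures behind them.
opaque
  middlesDominated⇒2≤weight₄ : ∀ x₀ x₁ x₂ x₃ → MiddleDominated x₀ x₁ x₂ → MiddleDominated x₁ x₂ x₃ →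
                               2 ≤ weight₄ x₀ x₁ x₂ x₃
  middlesDominated⇒2≤weight₄ = from-yes
    (∀-Letter? λ x₀ → ∀-Letter? λ x₁ → ∀-Letter? λ x₂ → ∀-Letter? λ x₃ →
      middleDominated? x₀ x₁ x₂ →-dec middleDominated? x₁ x₂ x₃ →-dec 2 ≤? weight₄ x₀ x₁ x₂ x₃)

  tightWindows⇒occursInBCAC : ∀ x₀ x₁ x₂ x₃ x₄ x₅ →
    MiddleDominated x₀ x₁ x₂ → MiddleDominated x₁ x₂ x₃ → MiddleDominated x₂ x₃ x₄ → MiddleDominated x₃ x₄ x₅ →
    weight₄ x₀ x₁ x₂ x₃ ≡ 2 → weight₄ x₁ x₂ x₃ x₄ ≡ 2 → weight₄ x₂ x₃ x₄ x₅ ≡ 2 → OccursInBCAC x₀ x₁ x₂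
  tightWindows⇒occursInBCAC = from-yes
    (∀-Letter? λ x₀ → ∀-Letter? λ x₁ → ∀-Letter? λ x₂ → ∀-Letter? λ x₃ → ∀-Letter? λ x₄ → ∀-Letter? λ x₅ →
      middleDominated? x₀ x₁ x₂ →-dec middleDominated? x₁ x₂ x₃ →-dec
      middleDominated? x₂ x₃ x₄ →-dec middleDominated? x₃ x₄ x₅ →-dec
      weight₄ x₀ x₁ x₂ x₃ ℕ.≟ 2 →-dec weight₄ x₁ x₂ x₃ x₄ ℕ.≟ 2 →-dec weight₄ x₂ x₃ x₄ x₅ ℕ.≟ 2 →-dec
      occursInBCAC? x₀ x₁ x₂)

module _ {n : ℕ} .{{_ : NonZero n}} {w : Word n} (dominating : Dominating w) where

  private
    W : ℕ → Letter
    W = cyclic w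

    window : ℕ → ℕ
    window = windowSum (letterWeight ∘ W) 4

    local : LocallyDominating W
    local = dominating⇒locallyDominating dominating

    2*weight≤⇒window≡2 : 2 * weight w ≤ n → ∀ m → window m ≡ 2
    2*weight≤⇒window≡2 light = periodic-sum≤⇒≡ (periodic-windowSum weight-periodic 4) 2≤window (begin
      sum (applyUpTo window n)                  ≡⟨ sum-windowSum weight-periodic 4 ⟩
      4 * sum (applyUpTo (letterWeight ∘ W) n)  ≡⟨ cong (4 *_) (weight≡sum-cyclic w) ⟨
      4 * weight w                              ≡⟨ *-assoc 2 2 (weight w) ⟩
      2 * (2 * weight w)                        ≤⟨ *-monoʳ-≤ 2 light ⟩
      2 * n                                     ≡⟨ *-comm 2 n ⟩
      n * 2                                     ∎)
      where
      open ≤-Reasoning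
      weight-periodic : Periodic n (letterWeight ∘ W)
      weight-periodic = cong letterWeight ∘ cyclic-periodic w
      2≤window : ∀ m → 2 ≤ window m
      2≤window m = middlesDominated⇒2≤weight₄ _ _ _ _ (local m) (local (1 + m))

  2*weight≤⇒shiftBCAC : 2 * weight w ≤ n → Σ[ r ∈ Fin 4 ] ∀ m → cyclic w m ≡ patBCAC (m + toℕ r)
  2*weight≤⇒shiftBCAC light = occursInBCAC⇒shiftBCAC {W} λ m →
    tightWindows⇒occursInBCAC _ _ _ _ _ _ (local m) (local (1 + m)) (local (2 + m)) (local (3 + m))
      (tight m) (tight (1 + m)) (tight (2 + m))
    where
    tight : ∀ m → window m ≡ 2
    tight = 2*weight≤⇒window≡2 light

lemma3p5 : (k : ℕ) → 1 ≤ k → (w : Word (4 * k)) → MinDominating w →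
    ((i : Fin (4 * k)) → w i ≢ D) × (countC w ≡ 2 * k) × (countAB w ≡ 2 * k) ×
    (RotationOf patBCAC w ⊎ RotationOf patACBC w)
lemma3p5 zero ()
lemma3p5 k@(suc _) _ w (dominating , minimal) =
  (λ i → patBCAC-≢D (toℕ i + toℕ r) ∘ trans (sym (w≡ i))) , count isC , count isAB , inj₁ rotation
  where
  light : 2 * weight w ≤ 4 * k
  light = ≤-trans (*-monoʳ-≤ 2 (minimal (BCAC-word k) (BCAC-word-dominating k)))
                  (≤-reflexive (trans (cong (2 *_) (weight-BCAC-word k)) (sym (*-assoc 2 2 k))))
  shift : Σ[ r ∈ Fin 4 ] ∀ m → cyclic w m ≡ patBCAC (m + toℕ r)
  shift = 2*weight≤⇒shiftBCAC dominating light
  r : Fin 4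
  r = proj₁ shift
  w≡ : ∀ i → w i ≡ patBCAC (toℕ i + toℕ r)
  w≡ i = trans (sym (cyclic-toℕ w i)) (proj₂ shift (toℕ i))
  count : ∀ g → sum (map (λ i → g (w i)) (allFin (4 * k))) ≡ sum (applyUpTo (g ∘ patBCAC) 4) * k
  count = sum-shiftBCAC k (toℕ r) w≡
  -- (ACBC)^ω is (BCAC)^ω shifted by two, so the first alternative always holds.
  rotation : RotationOf patBCAC w
  rotation = inject≤ r (m≤m*n 4 k) ,
             λ i → trans (w≡ i) (cong (λ l → patBCAC (toℕ i + l)) (sym (toℕ-inject≤ r (m≤m*n 4 k))))
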